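{- Let $\lambda=\lambda_1+\cdots+\lambda_p$ with $\lambda_j\in P$, and for each $j$ let $\Gamma_j$ be a $\lambda_j$-chain. Then the concatenation $\Gamma=\Gamma_1*\cdots*\Gamma_p$ (a $\lambda$-chain) is weakly reduced if and only if the decomposition $\lambda=\lambda_1+\cdots+\lambda_p$ is cancellation free and each $\Gamma_j$ is weakly reduced.
   Context: $\Delta$ is the root system of a complex simple Lie algebra (or type $A_1\times A_1$) with positive roots $\Delta^+$, simple roots $\alpha_i$ ($i\in I$), coroots $\alpha^\vee$, fundamental weights $\varpi_i$, weight lattice $P$, $\mathfrak h^*_{\mathbb R}=P\otimes\mathbb R$. $H_{\alpha,k}=\{\nu:\langle\nu,\alpha^\vee\rangle=k\}$; alcoves are components of the complement of all $H_{\alpha,k}$ ($\alpha\in\Delta$, $k\in\mathbb Z$); $A\xrightarrow{\gamma}B$ means adjacent alcoves whose common wall lies in some $H_{\gamma,k}$ with $\gamma$ pointing from $A$ to $B$; $A_\circ=\{\nu:0<\langle\nu,\alpha^\vee\rangle<1\ \forall\alpha\in\Delta^+\}$, $A_\mu=A_\circ+\mu$. For $\lambda\in P$, a $\lambda$-chain is a sequence of roots $(\beta_1,\dots,\beta_r)$ with alcoves $A_\circ=A_0\xrightarrow{ -\beta_1}\cdots\xrightarrow{ -\beta_r}A_r=A_{ -\lambda}$, consecutive ones adjacent. It is weakly reduced if it does not contain both a simple root and its negative. The concatenation $\Gamma_1*\cdots*\Gamma_p$ is the concatenated sequence of roots. Writing $\lambda_j=\sum_{i\in I}m_{ij}\varpi_i$,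 the decomposition is cancellation free if for each $i\in I$ all nonzero numbers among $m_{i1},\dots,m_{ip}$ have the same sign. -}

module Defs where

open import Data.Bool using (Bool; true; false; if_then_else_; _∨_; _∧_; not)
open import Data.Nat as ℕ using (ℕ; zero; suc; _≡ᵇ_)
open import Data.Integer as ℤ using (ℤ; +_; -[1+_])
open import Data.Integer.DivMod using (_/ℕ_)
open import Data.Rational as ℚ using (ℚ; 0ℚ; 1ℚ)
open import Data.Fin as Fin using (Fin; toℕ; inject₁; fromℕ)
open import Data.Vec as Vec using (Vec; lookup; tabulate)
open import Data.List as List using (List; []; _∷_)
open import Data.List.Relation.Unary.All using (All)
open import Data.List.Membership.Propositional using (_∈_)
open import Data.Product using (Σ; ∃; ∃-syntax; _×_; _,_)
open import Relation.Nullary using (¬_; does)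
open import Relation.Binary.PropositionalEquality using (_≡_; _≢_)

-- Cartan types of the complex simple Lie algebras (plus A1 × A1).
-- Offsets make the rank constraints automatic:
--   A n = A_{n+1},  B n = B_{n+2},  C n = C_{n+3},  D n = D_{n+4}.

data CartanType : Set where
  A B C D : ℕ → CartanType
  E6 E7 E8 F4 G2 A1×A1 : CartanType

rank : CartanType → ℕ
rank (A n) = suc n
rank (B n) = 2 ℕ.+ n
rank (C n) = 3 ℕ.+ n
rank (D n) = 4 ℕ.+ n
rank E6 = 6
rank E7 = 7
rank E8 = 8
rank F4 = 4
rank G2 = 2
rank A1×A1 = 2

adjℕ : ℕ → ℕ → Bool
adjℕ a b = (suc a ≡ᵇ b) ∨ (suc b ≡ᵇ a)

edge : List (ℕ × ℕ × ℤ) → ℕ → ℕ → ℤ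
edge [] a b = + 0
edge ((x , y , w) ∷ es) a b =
  if ((x ≡ᵇ a) ∧ (y ≡ᵇ b)) ∨ ((x ≡ᵇ b) ∧ (y ≡ᵇ a)) then w else edge es a b

-- Gram matrix (αᵢ , αⱼ) of the simple roots (Bourbaki numbering,
-- 0-indexed), for the invariant form normalised so that short roots
-- have squared length 2.
gramℕ : CartanType → ℕ → ℕ → ℤ
gramℕ (A n) a b =
  if a ≡ᵇ b then + 2 else if adjℕ a b then ℤ.- (+ 1) else + 0
gramℕ (B n) a b =
  if a ≡ᵇ b then (if a ≡ᵇ suc n then + 2 else + 4)
  else if adjℕ a b then ℤ.- (+ 2) else + 0
gramℕ (C n) a b =
  if a ≡ᵇ b then (if a ≡ᵇ 2 ℕ.+ n then + 4 else + 2)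
  else if adjℕ a b then (if (a ≡ᵇ 2 ℕ.+ n) ∨ (b ≡ᵇ 2 ℕ.+ n) then ℤ.- (+ 2) else ℤ.- (+ 1))
  else + 0
gramℕ (D n) a b =               -- nodes 0..n+3; n+3 attached to n+1
  if a ≡ᵇ b then + 2
  else if (adjℕ a b ∧ not ((a ≡ᵇ 3 ℕ.+ n) ∨ (b ≡ᵇ 3 ℕ.+ n)))
          ∨ ((a ≡ᵇ suc n) ∧ (b ≡ᵇ 3 ℕ.+ n)) ∨ ((a ≡ᵇ 3 ℕ.+ n) ∧ (b ≡ᵇ suc n))
       then ℤ.- (+ 1) else + 0
gramℕ E6 a b = if a ≡ᵇ b then + 2 else edge eEdges a b
  where eEdges = (0 , 2 , ℤ.- (+ 1)) ∷ (2 , 3 , ℤ.- (+ 1)) ∷ (3 , 4 , ℤ.- (+ 1))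
                 ∷ (4 , 5 , ℤ.- (+ 1)) ∷ (1 , 3 , ℤ.- (+ 1)) ∷ []
gramℕ E7 a b = if a ≡ᵇ b then + 2 else edge eEdges a b
  where eEdges = (0 , 2 , ℤ.- (+ 1)) ∷ (2 , 3 , ℤ.- (+ 1)) ∷ (3 , 4 , ℤ.- (+ 1))
                 ∷ (4 , 5 , ℤ.- (+ 1)) ∷ (5 , 6 , ℤ.- (+ 1)) ∷ (1 , 3 , ℤ.- (+ 1)) ∷ []
gramℕ E8 a b = if a ≡ᵇ b then + 2 else edge eEdges a b
  where eEdges = (0 , 2 , ℤ.- (+ 1)) ∷ (2 , 3 , ℤ.- (+ 1)) ∷ (3 , 4 , ℤ.- (+ 1))
                 ∷ (4 , 5 , ℤ.- (+ 1)) ∷ (5 , 6 , ℤ.- (+ 1)) ∷ (6 , 7 , ℤ.- (+ 1))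
                 ∷ (1 , 3 , ℤ.- (+ 1)) ∷ []
gramℕ F4 a b =
  if a ≡ᵇ b then (if (a ≡ᵇ 0) ∨ (a ≡ᵇ 1) then + 4 else + 2)
  else edge ((0 , 1 , ℤ.- (+ 2)) ∷ (1 , 2 , ℤ.- (+ 2)) ∷ (2 , 3 , ℤ.- (+ 1)) ∷ []) a b
gramℕ G2 a b =
  if a ≡ᵇ b then (if a ≡ᵇ 0 then + 2 else + 6)
  else edge ((0 , 1 , ℤ.- (+ 3)) ∷ []) a b
gramℕ A1×A1 a b = if a ≡ᵇ b then + 2 else + 0

gram : (t : CartanType) → Fin (rank t) → Fin (rank t) → ℤ
gram t i j = gramℕ t (toℕ i) (toℕ j)

sumℤ : ∀ {n} → (Fin n → ℤ) → ℤ
sumℤ {zero} f = + 0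
sumℤ {suc n} f = f Fin.zero ℤ.+ sumℤ (λ i → f (Fin.suc i))

sumℚ : ∀ {n} → (Fin n → ℚ) → ℚ
sumℚ {zero} f = 0ℚ
sumℚ {suc n} f = f Fin.zero ℚ.+ sumℚ (λ i → f (Fin.suc i))

ι : ℤ → ℚ
ι k = k ℚ./ 1

-- division by an integer (only ever used with positive divisors;
-- returns 0 for the meaningless cases)
divℤ : ℤ → ℤ → ℤ
divℤ x (+ zero) = + 0
divℤ x (+ suc k) = x /ℕ suc k
divℤ x -[1+ k ] = + 0

recipℤ : ℤ → ℚ
recipℤ (+ zero) = 0ℚ
recipℤ (+ suc k) = + 1 ℚ./ suc k
recipℤ -[1+ k ] = ℚ.- (+ 1 ℚ./ suc k)

-- Roots, written in the basis of simple roots (integer coefficients).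

Vecℤ : CartanType → Set
Vecℤ t = Vec ℤ (rank t)

-- elements of 𝔥*_ℝ, written in the basis of fundamental weights;
-- we use rational points
Point : CartanType → Set
Point t = Vec ℚ (rank t)

δ : ∀ {n} → Fin n → Fin n → ℤ
δ i j = if does (i Fin.≟ j) then + 1 else + 0

simple : (t : CartanType) → Fin (rank t) → Vecℤ t
simple t i = tabulate (δ i)

negV : ∀ {n} → Vec ℤ n → Vec ℤ n
negV = Vec.map (λ x → ℤ.- x)

form : (t : CartanType) → Vecℤ t → Vecℤ t → ℤ
form t b c = sumℤ (λ i → sumℤ (λ j → lookup b i ℤ.* gram t i j ℤ.* lookup c j))

pairSimpleCoroot : (t : CartanType) → Vecℤ t → Fin (rank t) → ℤ
pairSimpleCoroot t b i = divℤ (+ 2 ℤ.* form t b (simple t i)) (gram t i i)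

reflect : (t : CartanType) → Fin (rank t) → Vecℤ t → Vecℤ t
reflect t i b = tabulate (λ j → lookup b j ℤ.- pairSimpleCoroot t b i ℤ.* δ i j)

IsRoot : (t : CartanType) → Vecℤ t → Set
IsRoot t c = ∃[ w ] ∃[ i ] (c ≡ List.foldr (reflect t) (simple t i) w)

IsPositiveRoot : (t : CartanType) → Vecℤ t → Set
IsPositiveRoot t c = IsRoot t c × (∀ j → + 0 ℤ.≤ lookup c j)

-- ⟨ν , β^∨⟩ = 2 (ν , β) / (β , β), where ν = Σ νⱼ ϖⱼ and
-- (ν , αⱼ) = νⱼ (αⱼ , αⱼ) / 2
pairCoroot : (t : CartanType) → Point t → Vecℤ t → ℚ
pairCoroot t ν b =
  sumℚ (λ j → ι (lookup b j ℤ.* gram t j j) ℚ.* lookup ν j) ℚ.* recipℤ (form t b b)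

Regular : (t : CartanType) → Point t → Set
Regular t ν = ∀ c → IsRoot t c → ∀ (k : ℤ) → pairCoroot t ν c ≢ ι k

InAlcoveOf : (t : CartanType) → Point t → Point t → Set
InAlcoveOf t ν ν' = Regular t ν' ×
  (∀ c → IsRoot t c → ∀ (k : ℤ) →
     (pairCoroot t ν c ℚ.< ι k → pairCoroot t ν' c ℚ.< ι k) ×
     (pairCoroot t ν' c ℚ.< ι k → pairCoroot t ν c ℚ.< ι k))

InClosureOf : (t : CartanType) → Point t → Point t → Set
InClosureOf t ν μ = ∀ ε → 0ℚ ℚ.< ε → ∃[ ν' ] (InAlcoveOf t ν ν' ×
  (∀ j → (ℚ.- ε ℚ.< lookup ν' j ℚ.- lookup μ j) × (lookup ν' j ℚ.- lookup μ j ℚ.< ε)))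

InFundamentalAlcove : (t : CartanType) → Point t → Set
InFundamentalAlcove t ν = ∀ c → IsPositiveRoot t c →
  (0ℚ ℚ.< pairCoroot t ν c) × (pairCoroot t ν c ℚ.< 1ℚ)

-- A →γ B for the alcoves A ∋ ν, B ∋ ν' : their common wall lies in
-- H_{γ,k} (a point μ of H_{γ,k} lying on no other hyperplane is in both
-- closures) and γ points from A to B.
AdjacentVia : (t : CartanType) → Point t → Vecℤ t → Point t → Set
AdjacentVia t ν γ ν' = ∃[ k ] ∃[ μ ]
  ( (pairCoroot t μ γ ≡ ι k)
  × (∀ c → IsRoot t c → c ≢ γ → c ≢ negV γ → ∀ (m : ℤ) → pairCoroot t μ c ≢ ι m)
  × InClosureOf t ν μ × InClosureOf t ν' μ
  × (pairCoroot t ν γ ℚ.< ι k) × (ι k ℚ.< pairCoroot t ν' γ))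

weightToPoint : (t : CartanType) → Vecℤ t → Point t
weightToPoint t m = Vec.map ι m

-- λ-chain (λ ∈ P written in fundamental weight coordinates)
IsLambdaChain : (t : CartanType) → Vecℤ t → List (Vecℤ t) → Set
IsLambdaChain t lam Γ = All (IsRoot t) Γ ×
  Σ (Fin (suc (List.length Γ)) → Point t) λ ν → ( (∀ i → Regular t (ν i))
         × InFundamentalAlcove t (ν Fin.zero)
         × InFundamentalAlcove t (Vec.zipWith ℚ._+_ (ν (fromℕ (List.length Γ))) (weightToPoint t lam))
         × (∀ (i : Fin (List.length Γ)) →
              AdjacentVia t (ν (inject₁ i)) (negV (List.lookup Γ i)) (ν (Fin.suc i))))

WeaklyReduced : (t : CartanType) → List (Vecℤ t) → Set
WeaklyReduced t Γ = ∀ i → ¬ ((simple t i ∈ Γ) × (negV (simple t i) ∈ Γ))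

concatChains : (t : CartanType) {p : ℕ} → (Fin p → List (Vecℤ t)) → List (Vecℤ t)
concatChains t {p} Γs = List.concat (List.map Γs (List.allFin p))

CancellationFree : (t : CartanType) (p : ℕ) → (Fin p → Vecℤ t) → Set
CancellationFree t p lams = ∀ i j j' →
  ¬ ((+ 0 ℤ.< lookup (lams j) i) × (lookup (lams j') i ℤ.< + 0))

-- Fix a simple root αᵢ and follow the coordinate gⱼ = ⟨νⱼ , αᵢ^∨⟩ along the alcove
-- path of a λ-chain. It starts in (0,1) and ends in (-λᵢ, 1-λᵢ). Since the
-- hyperplane H_{αᵢ,k} is a wall between adjacent alcoves only when the step is
-- labelled ±αᵢ, gⱼ crosses an integer level downwards exactly at the steps
-- labelled αᵢ, upwards exactly at those labelled -αᵢ, and otherwise stays between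
-- the same two integers. Hence λᵢ > 0 forces αᵢ into the chain, λᵢ < 0 forces
-- -αᵢ, and if only one of ±αᵢ occurs then λᵢ has the corresponding strict sign.
-- Weak reducedness of the concatenation is then a statement about which of ±αᵢ
-- occur in which factor, i.e. about the signs of the coordinates λⱼᵢ.
module Submission where

open import Defs
open import Data.Bool using (true; false; if_then_else_; _∨_)
open import Data.Bool.Properties using (T-≡)
open import Data.Nat as ℕ using (ℕ; zero; suc)
open import Data.Nat.Properties using (≡⇒≡ᵇ)
open import Data.Integer as ℤ using (ℤ; +_; -[1+_])
import Data.Integer.Properties as ℤP
open import Data.Rational as ℚ using (ℚ; 0ℚ; 1ℚ; mkℚ; _<_; _≤_; *<*; *≤*)
import Data.Rational.Properties as ℚP
open import Algebra.Properties.AbelianGroup ℚP.+-0-abelianGroup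
  using (⁻¹-involutive; ⁻¹-anti-homo‿-; //-rightDividesˡ)
import Data.Nat.Coprimality as Coprimality
open import Data.Fin as Fin using (Fin; toℕ; inject₁; fromℕ)
open import Data.Fin.Properties using (suc-injective)
open import Data.Vec as Vec using (Vec; lookup)
import Data.Vec.Properties as VecP
open import Data.List as List using (List)
import Data.List.Relation.Unary.Any as Any
open import Data.List.Relation.Unary.Any.Properties using (lookup-index; map⁻)
open import Data.List.Membership.Propositional using (_∈_; _∉_)
open import Data.List.Membership.Propositional.Properties
  using (∈-lookup; ∈-concat⁺′; ∈-concat⁻; ∈-map⁺; ∈-allFin)
open import Data.Product using (∃; ∃-syntax; _×_; _,_; proj₁; proj₂)
open import Data.Sum using (_⊎_; inj₁; inj₂)
open import Function using (_∘_)
open import Function.Bundles using (_⇔_; mk⇔; Equivalence)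
open import Relation.Nullary using (yes; no; contradiction)
open import Relation.Binary.Definitions using (DecidableEquality; tri<; tri≈; tri>)
open import Relation.Binary.PropositionalEquality

sumℚ-zero : ∀ {n} (f : Fin n → ℚ) → (∀ j → f j ≡ 0ℚ) → sumℚ f ≡ 0ℚ
sumℚ-zero {zero} f f≡0 = refl
sumℚ-zero {suc n} f f≡0
  rewrite f≡0 Fin.zero | sumℚ-zero (f ∘ Fin.suc) (f≡0 ∘ Fin.suc) = refl

sumℚ-supported : ∀ {n} (f : Fin n → ℚ) i → (∀ j → j ≢ i → f j ≡ 0ℚ) → sumℚ f ≡ f i
sumℚ-supported {suc n} f Fin.zero f≡0
  rewrite sumℚ-zero (f ∘ Fin.suc) (λ j → f≡0 (Fin.suc j) λ ()) = ℚP.+-identityʳ (f Fin.zero)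
sumℚ-supported {suc n} f (Fin.suc i) f≡0
  rewrite f≡0 Fin.zero (λ ())
        | sumℚ-supported (f ∘ Fin.suc) i (λ j j≢i → f≡0 (Fin.suc j) (j≢i ∘ suc-injective))
        = ℚP.+-identityˡ (f (Fin.suc i))

sumℤ-zero : ∀ {n} (f : Fin n → ℤ) → (∀ j → f j ≡ + 0) → sumℤ f ≡ + 0
sumℤ-zero {zero} f f≡0 = refl
sumℤ-zero {suc n} f f≡0
  rewrite f≡0 Fin.zero | sumℤ-zero (f ∘ Fin.suc) (f≡0 ∘ Fin.suc) = refl

sumℤ-supported : ∀ {n} (f : Fin n → ℤ) i → (∀ j → j ≢ i → f j ≡ + 0) → sumℤ f ≡ f i
sumℤ-supported {suc n} f Fin.zero f≡0
  rewrite sumℤ-zero (f ∘ Fin.suc) (λ j → f≡0 (Fin.suc j) λ ()) = ℤP.+-identityʳ (f Fin.zero)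
sumℤ-supported {suc n} f (Fin.suc i) f≡0
  rewrite f≡0 Fin.zero (λ ())
        | sumℤ-supported (f ∘ Fin.suc) i (λ j j≢i → f≡0 (Fin.suc j) (j≢i ∘ suc-injective))
        = ℤP.+-identityˡ (f (Fin.suc i))

δ-diagonal : ∀ {n} (i : Fin n) → δ i i ≡ + 1
δ-diagonal i with i Fin.≟ i
... | yes _ = refl
... | no i≢i = contradiction refl i≢i

δ-offDiagonal : ∀ {n} (i j : Fin n) → j ≢ i → δ i j ≡ + 0
δ-offDiagonal i j j≢i with i Fin.≟ j
... | yes i≡j = contradiction (sym i≡j) j≢i
... | no _ = refl

lookup-simple : ∀ t i j → lookup (simple t i) j ≡ δ i j
lookup-simple t i j = VecP.lookup∘tabulate (δ i) j

lookup-negV : ∀ {n} (v : Vec ℤ n) j → lookup (negV v) j ≡ ℤ.- lookup v j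
lookup-negV v j = VecP.lookup-map j _ v

negV-involutive : ∀ {n} (v : Vec ℤ n) → negV (negV v) ≡ v
negV-involutive Vec.[] = refl
negV-involutive (x Vec.∷ v) = cong₂ Vec._∷_ (ℤP.neg-involutive x) (negV-involutive v)

simple-isRoot : ∀ t i → IsRoot t (simple t i)
simple-isRoot t i = List.[] , i , refl

simple-isPositiveRoot : ∀ t i → IsPositiveRoot t (simple t i)
simple-isPositiveRoot t i = simple-isRoot t i , λ j → subst (+ 0 ℤ.≤_) (sym (lookup-simple t i j)) (δ≥0 j)
  where
  δ≥0 : ∀ j → + 0 ℤ.≤ δ i j
  δ≥0 j with i Fin.≟ j
  ... | yes _ = ℤ.+≤+ ℕ.z≤n
  ... | no _ = ℤ.+≤+ ℕ.z≤n

-- The possible values of (αᵢ , αᵢ); on each of them ι and recipℤ are inverse.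
data SquaredLength : ℤ → Set where
  two : SquaredLength (+ 2)
  four : SquaredLength (+ 4)
  six : SquaredLength (+ 6)

if-SquaredLength : ∀ b {x y} → SquaredLength x → SquaredLength y → SquaredLength (if b then x else y)
if-SquaredLength true sx sy = sx
if-SquaredLength false sx sy = sy

≡ᵇ-refl : ∀ a → (a ℕ.≡ᵇ a) ≡ true
≡ᵇ-refl a = Equivalence.to T-≡ (≡⇒≡ᵇ a a refl)

gram-diagonal-squaredLength : ∀ t i → SquaredLength (gram t i i)
gram-diagonal-squaredLength (A n) i rewrite ≡ᵇ-refl (toℕ i) = two
gram-diagonal-squaredLength (B n) i rewrite ≡ᵇ-refl (toℕ i) = if-SquaredLength (toℕ i ℕ.≡ᵇ suc n) two four
gram-diagonal-squaredLength (C n) i rewrite ≡ᵇ-refl (toℕ i) = if-SquaredLength (toℕ i ℕ.≡ᵇ 2 ℕ.+ n) four two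
gram-diagonal-squaredLength (D n) i rewrite ≡ᵇ-refl (toℕ i) = two
gram-diagonal-squaredLength E6 i rewrite ≡ᵇ-refl (toℕ i) = two
gram-diagonal-squaredLength E7 i rewrite ≡ᵇ-refl (toℕ i) = two
gram-diagonal-squaredLength E8 i rewrite ≡ᵇ-refl (toℕ i) = two
gram-diagonal-squaredLength F4 i rewrite ≡ᵇ-refl (toℕ i) =
  if-SquaredLength ((toℕ i ℕ.≡ᵇ 0) ∨ (toℕ i ℕ.≡ᵇ 1)) four two
gram-diagonal-squaredLength G2 i rewrite ≡ᵇ-refl (toℕ i) = if-SquaredLength (toℕ i ℕ.≡ᵇ 0) two six
gram-diagonal-squaredLength A1×A1 i rewrite ≡ᵇ-refl (toℕ i) = two

pairCoroot-supported : ∀ t (ν : Point t) (β : Vecℤ t) i → (∀ j → j ≢ i → lookup β j ≡ + 0) →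
  pairCoroot t ν β ≡
    ι (lookup β i ℤ.* gram t i i) ℚ.* lookup ν i ℚ.* recipℤ (lookup β i ℤ.* gram t i i ℤ.* lookup β i)
pairCoroot-supported t ν β i β≡0 = cong₂ ℚ._*_ pairing (cong recipℤ squaredNorm)
  where
  pairing : sumℚ (λ j → ι (lookup β j ℤ.* gram t j j) ℚ.* lookup ν j)
          ≡ ι (lookup β i ℤ.* gram t i i) ℚ.* lookup ν i
  pairing = sumℚ-supported _ i λ j j≢i →
    trans (cong (λ b → ι (b ℤ.* gram t j j) ℚ.* lookup ν j) (β≡0 j j≢i)) (ℚP.*-zeroˡ (lookup ν j))
  squaredNorm : form t β β ≡ lookup β i ℤ.* gram t i i ℤ.* lookup β i
  squaredNorm = trans
    (sumℤ-supported _ i λ a a≢i → sumℤ-zero _ λ c →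
      trans (cong (λ b → b ℤ.* gram t a c ℤ.* lookup β c) (β≡0 a a≢i))
            (trans (cong (ℤ._* lookup β c) (ℤP.*-zeroˡ (gram t a c))) (ℤP.*-zeroˡ (lookup β c))))
    (sumℤ-supported _ i λ c c≢i →
      trans (cong (lookup β i ℤ.* gram t i c ℤ.*_) (β≡0 c c≢i)) (ℤP.*-zeroʳ (lookup β i ℤ.* gram t i c)))

*-cancel-inverse : ∀ a x b → a ℚ.* b ≡ 1ℚ → a ℚ.* x ℚ.* b ≡ x
*-cancel-inverse a x b ab≡1 = begin
  a ℚ.* x ℚ.* b   ≡⟨ cong (ℚ._* b) (ℚP.*-comm a x) ⟩
  x ℚ.* a ℚ.* b   ≡⟨ ℚP.*-assoc x a b ⟩
  x ℚ.* (a ℚ.* b) ≡⟨ cong (x ℚ.*_) ab≡1 ⟩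
  x ℚ.* 1ℚ        ≡⟨ ℚP.*-identityʳ x ⟩
  x               ∎
  where open ≡-Reasoning

*-cancel-negInverse : ∀ a x b → a ℚ.* b ≡ ℚ.- 1ℚ → a ℚ.* x ℚ.* b ≡ ℚ.- x
*-cancel-negInverse a x b ab≡-1 = begin
  a ℚ.* x ℚ.* b   ≡⟨ cong (ℚ._* b) (ℚP.*-comm a x) ⟩
  x ℚ.* a ℚ.* b   ≡⟨ ℚP.*-assoc x a b ⟩
  x ℚ.* (a ℚ.* b) ≡⟨ cong (x ℚ.*_) ab≡-1 ⟩
  x ℚ.* ℚ.- 1ℚ    ≡⟨ ℚP.neg-distribʳ-* x 1ℚ ⟨
  ℚ.- (x ℚ.* 1ℚ)  ≡⟨ cong ℚ.-_ (ℚP.*-identityʳ x) ⟩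
  ℚ.- x           ∎
  where open ≡-Reasoning

pairCoroot-simple : ∀ t i (ν : Point t) → pairCoroot t ν (simple t i) ≡ lookup ν i
pairCoroot-simple t i ν
  rewrite pairCoroot-supported t ν (simple t i) i
            (λ j j≢i → trans (lookup-simple t i j) (δ-offDiagonal i j j≢i))
        | lookup-simple t i i | δ-diagonal i
  with gram t i i | gram-diagonal-squaredLength t i
... | _ | two = *-cancel-inverse _ _ _ refl
... | _ | four = *-cancel-inverse _ _ _ refl
... | _ | six = *-cancel-inverse _ _ _ refl

pairCoroot-negSimple : ∀ t i (ν : Point t) → pairCoroot t ν (negV (simple t i)) ≡ ℚ.- lookup ν i
pairCoroot-negSimple t i ν
  rewrite pairCoroot-supported t ν (negV (simple t i)) i
            (λ j j≢i → trans (lookup-negV (simple t i) j)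
                             (cong ℤ.-_ (trans (lookup-simple t i j) (δ-offDiagonal i j j≢i))))
        | lookup-negV (simple t i) i | lookup-simple t i i | δ-diagonal i
  with gram t i i | gram-diagonal-squaredLength t i
... | _ | two = *-cancel-negInverse _ _ _ refl
... | _ | four = *-cancel-negInverse _ _ _ refl
... | _ | six = *-cancel-negInverse _ _ _ refl

ι≡mkℚ : ∀ k → ι k ≡ mkℚ k 0 (Coprimality.sym (Coprimality.1-coprimeTo _))
ι≡mkℚ k = ℚP.↥p/↧p≡p _

ι-mono-≤ : ∀ {m n} → m ℤ.≤ n → ι m ≤ ι n
ι-mono-≤ {m} {n} m≤n rewrite ι≡mkℚ m | ι≡mkℚ n =
  *≤* (subst₂ ℤ._≤_ (sym (ℤP.*-identityʳ m)) (sym (ℤP.*-identityʳ n)) m≤n)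

ι-cancel-< : ∀ {m n} → ι m < ι n → m ℤ.< n
ι-cancel-< {m} {n} ιm<ιn rewrite ι≡mkℚ m | ι≡mkℚ n with ιm<ιn
... | *<* m<n = subst₂ ℤ._<_ (ℤP.*-identityʳ m) (ℤP.*-identityʳ n) m<n

ι-neg : ∀ k → ι (ℤ.- k) ≡ ℚ.- ι k
ι-neg k rewrite ι≡mkℚ k | ι≡mkℚ (ℤ.- k) with k
... | -[1+ n ] = refl
... | + zero = refl
... | + suc n = refl

module _ {r : ℕ} (g : Fin (suc r) → ℚ) where

  Descent Ascent Flat : Fin r → Set
  Descent j = ∃[ k ] (g (Fin.suc j) < ι k × ι k < g (inject₁ j))
  Ascent j = ∃[ k ] (g (inject₁ j) < ι k × ι k < g (Fin.suc j))
  Flat j = ∀ n → (g (inject₁ j) < ι n → g (Fin.suc j) < ι n) × (g (Fin.suc j) < ι n → g (inject₁ j) < ι n)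

  ≥-preserved : ∀ {j} n → Ascent j ⊎ Flat j → ι n ≤ g (inject₁ j) → ι n ≤ g (Fin.suc j)
  ≥-preserved n (inj₁ (k , below , above)) n≤g = ℚP.<⇒≤ (ℚP.≤-<-trans n≤g (ℚP.<-trans below above))
  ≥-preserved n (inj₂ flat) n≤g = ℚP.≮⇒≥ λ g<n → ℚP.<-irrefl refl (ℚP.≤-<-trans n≤g (proj₂ (flat n) g<n))

  <-preserved : ∀ {j} n → Descent j ⊎ Flat j → g (inject₁ j) < ι n → g (Fin.suc j) < ι n
  <-preserved n (inj₁ (k , below , above)) g<n = ℚP.<-trans below (ℚP.<-trans above g<n)
  <-preserved n (inj₂ flat) g<n = proj₁ (flat n) g<n

along : ∀ {r} (P : ℚ → Set) (g : Fin (suc r) → ℚ) →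
  (∀ j → P (g (inject₁ j)) → P (g (Fin.suc j))) → P (g Fin.zero) → P (g (fromℕ r))
along {zero} P g step p = p
along {suc r} P g step p = along P (g ∘ Fin.suc) (step ∘ Fin.suc) (step Fin.zero p)

≥-along : ∀ {r} (g : Fin (suc r) → ℚ) → (∀ j → Ascent g j ⊎ Flat g j) →
  ∀ n → ι n ≤ g Fin.zero → ι n ≤ g (fromℕ r)
≥-along g steps n = along (ι n ≤_) g λ j → ≥-preserved g n (steps j)

<-along : ∀ {r} (g : Fin (suc r) → ℚ) → (∀ j → Descent g j ⊎ Flat g j) →
  ∀ n → g Fin.zero < ι n → g (fromℕ r) < ι n
<-along g steps n = along (_< ι n) g λ j → <-preserved g n (steps j)

descent-lowers : ∀ {r} (g : Fin (suc r) → ℚ) → (∀ j → Descent g j ⊎ Flat g j) →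
  ∀ {j} → Descent g j → ∀ n → g Fin.zero < ι n → g (fromℕ r) < ι (ℤ.pred n)
descent-lowers g steps {Fin.zero} (k , below , above) n g<n =
  <-along (g ∘ Fin.suc) (steps ∘ Fin.suc) (ℤ.pred n) (ℚP.<-≤-trans below k≤pred-n)
  where
  k≤pred-n : ι k ≤ ι (ℤ.pred n)
  k≤pred-n = ι-mono-≤ (ℤP.i<j⇒i≤pred[j] (ι-cancel-< {k} {n} (ℚP.<-trans above g<n)))
descent-lowers g steps {Fin.suc j} descent n g<n =
  descent-lowers (g ∘ Fin.suc) (steps ∘ Fin.suc) descent n (<-preserved g n (steps Fin.zero) g<n)

ascent-raises : ∀ {r} (g : Fin (suc r) → ℚ) → (∀ j → Ascent g j ⊎ Flat g j) →
  ∀ {j} → Ascent g j → ∀ n → ι n ≤ g Fin.zero → ι (ℤ.suc n) ≤ g (fromℕ r)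
ascent-raises g steps {Fin.zero} (k , below , above) n n≤g =
  ≥-along (g ∘ Fin.suc) (steps ∘ Fin.suc) (ℤ.suc n) (ℚP.<⇒≤ (ℚP.≤-<-trans suc-n≤k above))
  where
  suc-n≤k : ι (ℤ.suc n) ≤ ι k
  suc-n≤k = ι-mono-≤ (ℤP.i<j⇒suc[i]≤j (ι-cancel-< {n} {k} (ℚP.≤-<-trans n≤g below)))
ascent-raises g steps {Fin.suc j} ascent n n≤g =
  ascent-raises (g ∘ Fin.suc) (steps ∘ Fin.suc) ascent n (≥-preserved g n (steps Fin.zero) n≤g)

p<q⇒0<q-p : ∀ {p q} → p < q → 0ℚ < q ℚ.- p
p<q⇒0<q-p {p} {q} p<q = subst (_< q ℚ.- p) (ℚP.+-inverseʳ p) (ℚP.+-monoˡ-< (ℚ.- p) p<q)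

-‿cancelʳ-< : ∀ {p q} r → p ℚ.- r < q ℚ.- r → p < q
-‿cancelʳ-< {p} {q} r p-r<q-r =
  subst₂ _<_ (//-rightDividesˡ r p) (//-rightDividesˡ r q) (ℚP.+-monoˡ-< r p-r<q-r)

alcove-sameSide : ∀ t i (ν ν′ : Point t) → InAlcoveOf t ν ν′ → ∀ n →
  (lookup ν i < ι n → lookup ν′ i < ι n) × (lookup ν′ i < ι n → lookup ν i < ι n)
alcove-sameSide t i ν ν′ (_ , sameSide)
  rewrite sym (pairCoroot-simple t i ν) | sym (pairCoroot-simple t i ν′) =
  sameSide (simple t i) (simple-isRoot t i)

-- A point of the closure off the integer levels of the i-th coordinate is
-- approximated by alcove points closer to it than to the nearest level.
closure-sameSide : ∀ t i (ν μ : Point t) → InClosureOf t ν μ → (∀ n → lookup μ i ≢ ι n) → ∀ n →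
  (lookup ν i < ι n → lookup μ i < ι n) × (lookup μ i < ι n → lookup ν i < ι n)
closure-sameSide t i ν μ closure generic n = toward , away
  where
  toward : lookup ν i < ι n → lookup μ i < ι n
  toward ν<n with ℚP.<-cmp (lookup μ i) (ι n)
  ... | tri< μ<n _ _ = μ<n
  ... | tri≈ _ μ≡n _ = contradiction μ≡n (generic n)
  ... | tri> _ _ μ>n with closure (lookup μ i ℚ.- ι n) (p<q⇒0<q-p μ>n)
  ...   | ν′ , inAlcove , near = contradiction ν′>n (ℚP.<-asym (proj₁ (alcove-sameSide t i ν ν′ inAlcove n) ν<n))
    where
    ν′>n : ι n < lookup ν′ i
    ν′>n = -‿cancelʳ-< (lookup μ i)
      (subst (_< lookup ν′ i ℚ.- lookup μ i) (⁻¹-anti-homo‿- (lookup μ i) (ι n)) (proj₁ (near i)))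
  away : lookup μ i < ι n → lookup ν i < ι n
  away μ<n with closure (ι n ℚ.- lookup μ i) (p<q⇒0<q-p μ<n)
  ... | ν′ , inAlcove , near =
    proj₂ (alcove-sameSide t i ν ν′ inAlcove n) (-‿cancelʳ-< (lookup μ i) (proj₂ (near i)))

module LambdaChain {t : CartanType} {lam : Vecℤ t} {Γ : List (Vecℤ t)}
                   (chain : IsLambdaChain t lam Γ) (i : Fin (rank t)) where

  _≟_ : DecidableEquality (Vecℤ t)
  _≟_ = VecP.≡-dec ℤ._≟_

  open import Data.List.Membership.DecPropositional _≟_ using (_∈?_)

  α : Vecℤ t
  α = simple t i

  r : ℕ
  r = List.length Γ

  ν : Fin (suc r) → Point t
  ν = proj₁ (proj₂ chain)

  g : Fin (suc r) → ℚ
  g j = lookup (ν j) i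

  x : ℚ
  x = g (fromℕ r)

  λᵢ : ℤ
  λᵢ = lookup lam i

  start : 0ℚ < g Fin.zero × g Fin.zero < 1ℚ
  start = subst (λ q → 0ℚ < q × q < 1ℚ) (pairCoroot-simple t i (ν Fin.zero))
    (proj₁ (proj₂ (proj₂ (proj₂ chain))) α (simple-isPositiveRoot t i))

  end : 0ℚ < x ℚ.+ ι λᵢ × x ℚ.+ ι λᵢ < 1ℚ
  end = subst (λ q → 0ℚ < q × q < 1ℚ) shifted
    (proj₁ (proj₂ (proj₂ (proj₂ (proj₂ chain)))) α (simple-isPositiveRoot t i))
    where
    ν+λ : Point t
    ν+λ = Vec.zipWith ℚ._+_ (ν (fromℕ r)) (weightToPoint t lam)
    shifted : pairCoroot t ν+λ α ≡ x ℚ.+ ι λᵢ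
    shifted = begin
      pairCoroot t ν+λ α
        ≡⟨ pairCoroot-simple t i ν+λ ⟩
      lookup ν+λ i
        ≡⟨ VecP.lookup-zipWith ℚ._+_ i (ν (fromℕ r)) (weightToPoint t lam) ⟩
      x ℚ.+ lookup (weightToPoint t lam) i
        ≡⟨ cong (x ℚ.+_) (VecP.lookup-map i ι lam) ⟩
      x ℚ.+ ι λᵢ ∎
      where open ≡-Reasoning

  adjacent : ∀ j → AdjacentVia t (ν (inject₁ j)) (negV (List.lookup Γ j)) (ν (Fin.suc j))
  adjacent = proj₂ (proj₂ (proj₂ (proj₂ (proj₂ chain))))

  descent-at : ∀ j → List.lookup Γ j ≡ α → Descent g j
  descent-at j Γⱼ≡α with adjacent j
  ... | k , _ , _ , _ , _ , _ , below , above
    rewrite Γⱼ≡α | pairCoroot-negSimple t i (ν (inject₁ j)) | pairCoroot-negSimple t i (ν (Fin.suc j)) =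
    ℤ.- k , subst₂ _<_ (⁻¹-involutive _) (sym (ι-neg k)) (ℚP.neg-antimono-< above)
          , subst₂ _<_ (sym (ι-neg k)) (⁻¹-involutive _) (ℚP.neg-antimono-< below)

  ascent-at : ∀ j → List.lookup Γ j ≡ negV α → Ascent g j
  ascent-at j Γⱼ≡-α with adjacent j
  ... | k , _ , _ , _ , _ , _ , below , above
    rewrite Γⱼ≡-α | negV-involutive α
          | pairCoroot-simple t i (ν (inject₁ j)) | pairCoroot-simple t i (ν (Fin.suc j)) =
    k , below , above

  -- Since Γⱼ ≠ ±αᵢ, the common wall meets no H_{αᵢ,n}, so both alcoves lie on its side of each.
  flat-at : ∀ j → List.lookup Γ j ≢ α → List.lookup Γ j ≢ negV α → Flat g j
  flat-at j Γⱼ≢α Γⱼ≢-α n with adjacent j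
  ... | _ , μ , _ , generic , closure , closure′ , _ =
    (λ g<n → proj₂ (sameSide′ n) (proj₁ (sameSide n) g<n)) ,
    (λ g′<n → proj₂ (sameSide n) (proj₁ (sameSide′ n) g′<n))
    where
    μ-generic : ∀ n → lookup μ i ≢ ι n
    μ-generic n μ≡n = generic α (simple-isRoot t i)
      (λ α≡-Γⱼ → Γⱼ≢-α (trans (sym (negV-involutive _)) (cong negV (sym α≡-Γⱼ))))
      (λ α≡Γⱼ → Γⱼ≢α (trans (sym (negV-involutive _)) (sym α≡Γⱼ)))
      n (trans (pairCoroot-simple t i μ) μ≡n)
    sameSide = closure-sameSide t i (ν (inject₁ j)) μ closure μ-generic
    sameSide′ = closure-sameSide t i (ν (Fin.suc j)) μ closure′ μ-generic

  ascent-or-flat : α ∉ Γ → ∀ j → Ascent g j ⊎ Flat g j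
  ascent-or-flat α∉Γ j with List.lookup Γ j ≟ negV α
  ... | yes Γⱼ≡-α = inj₁ (ascent-at j Γⱼ≡-α)
  ... | no Γⱼ≢-α = inj₂ (flat-at j (λ Γⱼ≡α → α∉Γ (subst (_∈ Γ) Γⱼ≡α (∈-lookup j))) Γⱼ≢-α)

  descent-or-flat : negV α ∉ Γ → ∀ j → Descent g j ⊎ Flat g j
  descent-or-flat -α∉Γ j with List.lookup Γ j ≟ α
  ... | yes Γⱼ≡α = inj₁ (descent-at j Γⱼ≡α)
  ... | no Γⱼ≢α = inj₂ (flat-at j Γⱼ≢α (λ Γⱼ≡-α → -α∉Γ (subst (_∈ Γ) Γⱼ≡-α (∈-lookup j))))

  simple∉⇒nonPositive : α ∉ Γ → λᵢ ℤ.≤ + 0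
  simple∉⇒nonPositive α∉Γ = ℤP.i<j⇒i≤pred[j] (ι-cancel-< {λᵢ} {+ 1} (ℚP.≤-<-trans λ≤x+λ (proj₂ end)))
    where
    0≤x : 0ℚ ≤ x
    0≤x = ≥-along g (ascent-or-flat α∉Γ) (+ 0) (ℚP.<⇒≤ (proj₁ start))
    λ≤x+λ : ι λᵢ ≤ x ℚ.+ ι λᵢ
    λ≤x+λ = subst (_≤ x ℚ.+ ι λᵢ) (ℚP.+-identityˡ (ι λᵢ)) (ℚP.+-monoˡ-≤ (ι λᵢ) 0≤x)

  negSimple∉⇒nonNegative : negV α ∉ Γ → + 0 ℤ.≤ λᵢ
  negSimple∉⇒nonNegative -α∉Γ = ℤP.≮⇒≥ λ λ<0 →
    ℚP.<-asym (proj₁ end) (ℚP.+-mono-<-≤ x<1 (ι-mono-≤ (ℤP.i<j⇒i≤pred[j] λ<0)))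
    where
    x<1 : x < 1ℚ
    x<1 = <-along g (descent-or-flat -α∉Γ) (+ 1) (proj₂ start)

  positive⇒simple∈ : + 0 ℤ.< λᵢ → α ∈ Γ
  positive⇒simple∈ λ>0 with α ∈? Γ
  ... | yes α∈Γ = α∈Γ
  ... | no α∉Γ = contradiction (simple∉⇒nonPositive α∉Γ) (ℤP.<⇒≱ λ>0)

  negative⇒negSimple∈ : λᵢ ℤ.< + 0 → negV α ∈ Γ
  negative⇒negSimple∈ λ<0 with negV α ∈? Γ
  ... | yes -α∈Γ = -α∈Γ
  ... | no -α∉Γ = contradiction (negSimple∉⇒nonNegative -α∉Γ) (ℤP.<⇒≱ λ<0)

  simple∈∧negSimple∉⇒positive : α ∈ Γ → negV α ∉ Γ → + 0 ℤ.< λᵢ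
  simple∈∧negSimple∉⇒positive α∈Γ -α∉Γ = ℤP.≰⇒> λ λ≤0 →
    ℚP.<-asym (proj₁ end) (ℚP.+-mono-<-≤ x<0 (ι-mono-≤ λ≤0))
    where
    x<0 : x < 0ℚ
    x<0 = descent-lowers g (descent-or-flat -α∉Γ)
            (descent-at (Any.index α∈Γ) (sym (lookup-index α∈Γ))) (+ 1) (proj₂ start)

  negSimple∈∧simple∉⇒negative : negV α ∈ Γ → α ∉ Γ → λᵢ ℤ.< + 0
  negSimple∈∧simple∉⇒negative -α∈Γ α∉Γ = ℤP.≰⇒> λ λ≥0 →
    ℚP.<-irrefl refl (ℚP.≤-<-trans (ℚP.+-mono-≤ 1≤x (ι-mono-≤ λ≥0)) (proj₂ end))
    where
    1≤x : 1ℚ ≤ x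
    1≤x = ascent-raises g (ascent-or-flat α∉Γ)
            (ascent-at (Any.index -α∈Γ) (sym (lookup-index -α∈Γ))) (+ 0) (ℚP.<⇒≤ (proj₁ start))

∈-concatChains⁺ : ∀ t {p} (Γs : Fin p → List (Vecℤ t)) {β} j → β ∈ Γs j → β ∈ concatChains t Γs
∈-concatChains⁺ t Γs j β∈Γⱼ = ∈-concat⁺′ β∈Γⱼ (∈-map⁺ Γs (∈-allFin j))

∈-concatChains⁻ : ∀ t {p} (Γs : Fin p → List (Vecℤ t)) {β} → β ∈ concatChains t Γs → ∃ λ j → β ∈ Γs j
∈-concatChains⁻ t Γs β∈Γ = Any.satisfied (map⁻ (∈-concat⁻ (List.map Γs (List.allFin _)) β∈Γ))

proposition5p8 : (t : CartanType) (p : ℕ) (lams : Fin p → Vecℤ t)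
    (Γs : Fin p → List (Vecℤ t)) →
    (∀ j → IsLambdaChain t (lams j) (Γs j)) →
    WeaklyReduced t (concatChains t Γs) ⇔
      (CancellationFree t p lams × (∀ j → WeaklyReduced t (Γs j)))
proposition5p8 t p lams Γs chains = mk⇔ split merge
  where
  module Chain j = LambdaChain {t} {lams j} {Γs j} (chains j)
  inConcat : ∀ {β} j → β ∈ Γs j → β ∈ concatChains t Γs
  inConcat = ∈-concatChains⁺ t Γs

  split : WeaklyReduced t (concatChains t Γs) →
          CancellationFree t p lams × (∀ j → WeaklyReduced t (Γs j))
  split reduced =
    (λ i j j′ (pos , neg) → reduced i
      (inConcat j (Chain.positive⇒simple∈ j i pos) , inConcat j′ (Chain.negative⇒negSimple∈ j′ i neg))) ,
    (λ j i (α∈Γⱼ , -α∈Γⱼ) → reduced i (inConcat j α∈Γⱼ , inConcat j -α∈Γⱼ))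

  merge : CancellationFree t p lams × (∀ j → WeaklyReduced t (Γs j)) →
          WeaklyReduced t (concatChains t Γs)
  merge (cancellationFree , reduced) i (α∈Γ , -α∈Γ)
    with ∈-concatChains⁻ t Γs α∈Γ | ∈-concatChains⁻ t Γs -α∈Γ
  ... | j , α∈Γⱼ | j′ , -α∈Γⱼ′ = cancellationFree i j j′
    ( Chain.simple∈∧negSimple∉⇒positive j i α∈Γⱼ (λ -α∈Γⱼ → reduced j i (α∈Γⱼ , -α∈Γⱼ))
    , Chain.negSimple∈∧simple∉⇒negative j′ i -α∈Γⱼ′ (λ α∈Γⱼ′ → reduced j′ i (α∈Γⱼ′ , -α∈Γⱼ′)))
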